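{- Consider the game of cops and robber on a connected graph $G$. Suppose that on the cops' turn at least two cops $C_1,C_2$ are located at a vertex $v$ and the robber is located at a vertex $w\ne v$. Let $P$ be a $(w,v)$-geodesic path in $G$ and let $u$ be the vertex of $P$ preceding $v$, i.e. the neighbor of $v$ on $P$. Let $X=N_G(v)\setminus\{u\}$ and let $H$ be the connected component of $G-X$ containing $v$. If $C_2$ moves to $u$ and thereafter $C_1$ stays on $v$ and $C_2$ stays on $u$ for the rest of the game, then the robber, as long as it is not captured, is confined to the vertices of $H$.
   Context: Game of cops and robber: players alternate turns. On the cops' turn each cop moves to an adjacent vertex or stays; on the robber's turn the robber does the same. The robber is captured when a cop occupies its vertex.
   Formalization: The robber is deemed not captured through a given cops' turn only when at each cops' turn up to then it is on neither u, v nor any neighbour of v, and G is finite. Each condition added here is assumed in the paper as well or is needed for the statement above to hold. -}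

module Defs where

open import Level using (0ℓ)
open import Data.Nat using (ℕ; zero; suc; _≤_)
open import Data.Fin using (Fin; fromℕ; inject₁)
open import Data.Unit using (⊤)
open import Data.Product using (_×_)
open import Data.Sum using (_⊎_)
open import Relation.Nullary using (¬_)
open import Relation.Binary.PropositionalEquality using (_≡_; _≢_)

record Graph (n : ℕ) : Set₁ where
  field
    Adj    : Fin n → Fin n → Set
    symAdj : ∀ {x y} → Adj x y → Adj y x
    irrefl : ∀ {x} → ¬ Adj x x

open Graph public

data WalkIn {n : ℕ} (G : Graph n) (P : Fin n → Set) : Fin n → Fin n → Set where
  here : ∀ {x} → P x → WalkIn G P x x
  step : ∀ {x y z} → P x → Adj G x y → WalkIn G P y z → WalkIn G P x z

len : ∀ {n} {G : Graph n} {P : Fin n → Set} {x y : Fin n} → WalkIn G P x y → ℕ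
len (here _) = zero
len (step _ _ q) = suc (len q)

Walk : ∀ {n} → Graph n → Fin n → Fin n → Set
Walk G = WalkIn G (λ _ → ⊤)

Connected : ∀ {n} → Graph n → Set
Connected G = ∀ x y → Walk G x y

IsWalkSeq : ∀ {n} → Graph n → (m : ℕ) → (Fin (suc (suc m)) → Fin n) → Set
IsWalkSeq G m p = ∀ (i : Fin (suc m)) → Adj G (p (inject₁ i)) (p (Fin.suc i))
  where import Data.Fin as Fin

IsGeodesic : ∀ {n} → Graph n → Fin n → Fin n → (m : ℕ) → (Fin (suc (suc m)) → Fin n) → Set
IsGeodesic G w v m p =
  (p Data.Fin.zero ≡ w) × (p (fromℕ (suc m)) ≡ v) × IsWalkSeq G m p
  × (∀ (q : Walk G w v) → suc m ≤ len q)
  where import Data.Fin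

penultimate : ∀ {n} (m : ℕ) → (Fin (suc (suc m)) → Fin n) → Fin n
penultimate m p = p (inject₁ (fromℕ m))

InX : ∀ {n} → Graph n → (v u : Fin n) → Fin n → Set
InX G v u z = Adj G v z × z ≢ u

-- vertex set of H = the connected component of G - X containing v
InH : ∀ {n} → Graph n → (v u : Fin n) → Fin n → Set
InH G v u y = WalkIn G (λ z → ¬ InX G v u z) v y

-- A robber trajectory: r i = robber's position at the i-th cops' turn
-- (r 0 = w when C2 moves to u); on each robber turn it moves to a
-- neighbour or stays.
IsRobberWalk : ∀ {n} → Graph n → Fin n → (ℕ → Fin n) → Set
IsRobberWalk G w r = (r 0 ≡ w) × (∀ i → (r (suc i) ≡ r i) ⊎ Adj G (r i) (r (suc i)))

-- With C1 on v and C2 on u, the robber is captured at a cops' turn at which it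
-- stands on u or v, or on a neighbour of v (C1 then steps onto it).
NotCapturedAt : ∀ {n} → Graph n → (v u : Fin n) → Fin n → Set
NotCapturedAt G v u x = (x ≢ v) × (x ≢ u) × ¬ Adj G v x

{-# OPTIONS --safe #-}
-- The reversed geodesic runs from v to w inside G - X: its last vertex u is
-- excluded from X by definition, and any earlier vertex adjacent to v would
-- give a shortcut to v. So the robber starts in H. To leave H it must step
-- onto a vertex of X, i.e. a neighbour of v, where the cop on v catches it.
module Submission where

open import Defs
open import Data.Nat using (ℕ; zero; suc; _≤_; s≤s)
open import Data.Nat.Properties using (≤-refl; ≤-pred; m≤n⇒m≤1+n)
open import Data.Fin using (Fin; zero; suc; fromℕ)
open import Data.Product using (_,_; proj₁; proj₂)
open import Data.Sum using ([_,_])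
open import Data.Unit using (tt)
open import Function using (_∘_)
open import Relation.Nullary using (¬_)
open import Relation.Binary.PropositionalEquality using (refl; sym; subst; _≢_)

module _ {n : ℕ} {G : Graph n} {P : Fin n → Set} where

  snoc : ∀ {x y z} → WalkIn G P x y → Adj G y z → P z → WalkIn G P x z
  snoc (here px)       y~z pz = step px y~z (here pz)
  snoc (step px x~y q) y~z pz = step px x~y (snoc q y~z pz)

module _ {n : ℕ} (G : Graph n) where

  Shortest : Fin n → Fin n → ℕ → Set
  Shortest x y k = ∀ (q : Walk G x y) → k ≤ len q

  Shortest-tail : ∀ {x y z k} → Adj G x y → Shortest x z (suc k) → Shortest y z k
  Shortest-tail x~y sh q = ≤-pred (sh (step tt x~y q))

  Shortest⇒¬Adj : ∀ {x y k} → Shortest x y (suc (suc k)) → ¬ Adj G x y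
  Shortest⇒¬Adj sh x~y with sh (step tt x~y (here tt))
  ... | s≤s ()

  shortestPath-start-InH : ∀ m (p : Fin (suc (suc m)) → Fin n) → IsWalkSeq G m p →
    Shortest (p zero) (p (fromℕ (suc m))) (suc m) →
    InH G (p (fromℕ (suc m))) (penultimate m p) (p zero)
  shortestPath-start-InH zero p seq _ =
    step (irrefl G ∘ proj₁) (symAdj G (seq zero)) (here λ (_ , u≢u) → u≢u refl)
  shortestPath-start-InH (suc m) p seq sh =
    snoc (shortestPath-start-InH m (p ∘ suc) (seq ∘ suc) (Shortest-tail (seq zero) sh))
         (symAdj G (seq zero))
         (λ (v~p₀ , _) → Shortest⇒¬Adj sh (symAdj G v~p₀))

  InH-step : ∀ {v u x y} → InH G v u x → Adj G x y → ¬ Adj G v y → InH G v u y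
  InH-step x∈H x~y v≁y = snoc x∈H x~y (v≁y ∘ proj₁)

  robber-confined : ∀ {v u w r} → IsRobberWalk G w r → InH G v u w →
    ∀ t → (∀ i → i ≤ t → NotCapturedAt G v u (r i)) → InH G v u (r t)
  robber-confined (refl , _) w∈H zero _ = w∈H
  robber-confined {v} {u} {r = r} walk@(_ , move) w∈H (suc t) uncaught =
    [ (λ stay → subst (InH G v u) (sym stay) r-t∈H)
    , (λ r-t~r-t+1 → InH-step r-t∈H r-t~r-t+1 (proj₂ (proj₂ (uncaught (suc t) ≤-refl))))
    ] (move t)
    where
    r-t∈H : InH G v u (r t)
    r-t∈H = robber-confined walk w∈H t (λ i i≤t → uncaught i (m≤n⇒m≤1+n i≤t))

-- Connectivity and w ≢ v only guarantee that a geodesic exists; here it is given.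
proposition6 : ∀ {n} (G : Graph n) → Connected G →
    (v w : Fin n) → w ≢ v →
    (m : ℕ) (p : Fin (suc (suc m)) → Fin n) → IsGeodesic G w v m p →
    (r : ℕ → Fin n) → IsRobberWalk G w r →
    (t : ℕ) → (∀ i → i ≤ t → NotCapturedAt G v (penultimate m p) (r i)) →
    InH G v (penultimate m p) (r t)
proposition6 G _ _ _ _ m p (refl , refl , seq , geodesic) r robber =
  robber-confined G robber (shortestPath-start-InH G m p seq geodesic)
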